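{- Let $2k+1$ be a prime and $n\ge 1$. The complete graph $K_n$ admits a $(2k+1)$-neighborhood balanced coloring if and only if $n=1$.
   Context: For a prime $2k+1$ (with $k\ge 1$), a $(2k+1)$-neighborhood balanced coloring of a finite simple graph $G$ is an assignment to each vertex of one of $2k+1$ colors $R_1,\dots,R_{2k+1}$ such that every vertex has an equal number of neighbors of each color. -}

module Defs where

open import Data.Nat using (ℕ; suc; _+_; _*_)
open import Data.Fin using (Fin)
open import Data.Fin.Properties using (_≟_)
open import Data.List using (List; filter; length)
open import Data.List.Base using (allFin)
open import Data.Product using (_×_)
open import Relation.Nullary using (¬_; Dec)
open import Relation.Nullary.Decidable using (_×-dec_; ¬?)
open import Relation.Binary.PropositionalEquality using (_≡_)

record SimpleGraph (n : ℕ) : Set₁ where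
  field
    Adj       : Fin n → Fin n → Set
    adj?      : ∀ u v → Dec (Adj u v)
    symmetric : ∀ {u v} → Adj u v → Adj v u
    loopless  : ∀ v → ¬ Adj v v
open SimpleGraph public

K : (n : ℕ) → SimpleGraph n
K n = record
  { Adj       = λ u v → ¬ (u ≡ v)
  ; adj?      = λ u v → ¬? (u ≟ v)
  ; symmetric = λ p q → p (Relation.Binary.PropositionalEquality.sym q)
  ; loopless  = λ v p → p Relation.Binary.PropositionalEquality.refl
  }

nbrsWithColour : ∀ {n m} (G : SimpleGraph n) → (Fin n → Fin m) →
                 Fin n → Fin m → ℕ
nbrsWithColour {n} G col v c =
  length (filter (λ u → adj? G v u ×-dec (col u ≟ c)) (allFin n))

IsNBColouring : ∀ {n} (m : ℕ) → SimpleGraph n → (Fin n → Fin m) → Set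
IsNBColouring m G col = ∀ v c d → nbrsWithColour G col v c ≡ nbrsWithColour G col v d

AdmitsNBColouring : ∀ {n} (m : ℕ) → SimpleGraph n → Set
AdmitsNBColouring {n} m G = Data.Product.Σ (Fin n → Fin m) (IsNBColouring m G)

-- In K_n every vertex v sees every vertex except itself, so the number of
-- neighbours of v of colour c is the size of the colour class of c, minus
-- one when c is the colour of v. Balance at v therefore forces the class of
-- v's own colour to be strictly larger than every other class. Two vertices
-- of different colours would each have the strictly larger class, so a
-- balanced colouring is monochromatic; but then, for n ≥ 2, a vertex has
-- n - 1 > 0 neighbours of its own colour and none of any other colour.
module Submission where

open import Defs
open import Data.Fin using (Fin; zero; suc)
open import Data.Fin.Properties using (_≟_)
open import Data.List using ([]; _∷_; filter; length)
open import Data.List.Base using (allFin)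
open import Data.List.Membership.Propositional.Properties using (∈-allFin; ∈-filter⁺; ∈-length)
open import Data.List.Properties using (filter-none)
open import Data.List.Relation.Unary.All using (universal)
open import Data.Nat using (ℕ; zero; suc; _+_; _*_; _<_; _≥_; s≤s; z≤n)
open import Data.Nat.Base using (nonTrivial⇒n>1)
open import Data.Nat.Primality using (Prime; prime⇒nonTrivial)
open import Data.Nat.Properties using (+-suc; <-asym; <⇒≢; <⇒≤; m<n+m; module ≤-Reasoning)
open import Data.Product using (_,_; ∃-syntax)
open import Data.Empty using (⊥-elim)
open import Function using (_∘_)
open import Function.Bundles using (_⇔_; mk⇔)
open import Level using (0ℓ)
open import Relation.Binary.PropositionalEquality using (_≡_; _≢_; refl; sym; trans; cong; module ≡-Reasoning)
open import Relation.Nullary using (¬_; yes; no)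
open import Relation.Nullary.Decidable using (_×-dec_; ¬?)
open import Relation.Unary using (Pred; Decidable)

module _ {A : Set} {P Q : Pred A 0ℓ} (P? : Decidable P) (Q? : Decidable Q) where

  length-filter-×-split : ∀ xs →
    length (filter (λ x → P? x ×-dec Q? x) xs) + length (filter (λ x → ¬? (P? x) ×-dec Q? x) xs)
      ≡ length (filter Q? xs)
  length-filter-×-split [] = refl
  length-filter-×-split (x ∷ xs) with P? x | Q? x
  ... | yes _ | yes _ = cong suc (length-filter-×-split xs)
  ... | yes _ | no _  = length-filter-×-split xs
  ... | no _  | yes _ = trans (+-suc _ _) (cong suc (length-filter-×-split xs))
  ... | no _  | no _  = length-filter-×-split xs

∃-≢ : ∀ {m} → 1 < m → (c : Fin m) → ∃[ d ] c ≢ d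
∃-≢ (s≤s (s≤s z≤n)) zero    = suc zero , λ ()
∃-≢ (s≤s (s≤s z≤n)) (suc _) = zero , λ ()

module CompleteGraph {n m : ℕ} (col : Fin n → Fin m) where

  classSize : Fin m → ℕ
  classSize c = length (filter (λ w → col w ≟ c) (allFin n))

  nbrs : Fin n → Fin m → ℕ
  nbrs = nbrsWithColour (K n) col

  private
    selfCount : Fin n → Fin m → ℕ
    selfCount v c = length (filter (λ w → (v ≟ w) ×-dec (col w ≟ c)) (allFin n))

    selfCount+nbrs≡classSize : ∀ v c → selfCount v c + nbrs v c ≡ classSize c
    selfCount+nbrs≡classSize v c = length-filter-×-split (v ≟_) (λ w → col w ≟ c) (allFin n)

  classSize≡0 : ∀ {c} → (∀ v → col v ≢ c) → classSize c ≡ 0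
  classSize≡0 {c} uncoloured = cong length (filter-none (λ w → col w ≟ c) (universal uncoloured (allFin n)))

  nbrs>0 : ∀ v {u c} → v ≢ u → col u ≡ c → 0 < nbrs v c
  nbrs>0 v {u} {c} v≢u col[u]≡c =
    ∈-length (∈-filter⁺ (λ w → adj? (K n) v w ×-dec (col w ≟ c)) (∈-allFin u) (v≢u , col[u]≡c))

  nbrs≡classSize : ∀ v {c} → col v ≢ c → nbrs v c ≡ classSize c
  nbrs≡classSize v {c} col[v]≢c = trans (cong (_+ nbrs v c) (sym selfCount≡0)) (selfCount+nbrs≡classSize v c)
    where
    selfCount≡0 : selfCount v c ≡ 0
    selfCount≡0 = cong length (filter-none _ (universal (λ { _ (refl , e) → col[v]≢c e }) (allFin n)))

  nbrs-own<classSize : ∀ v → nbrs v (col v) < classSize (col v)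
  nbrs-own<classSize v = begin-strict
    nbrs v (col v)                       <⟨ m<n+m _ (∈-length (∈-filter⁺ _ (∈-allFin v) (refl , refl))) ⟩
    selfCount v (col v) + nbrs v (col v) ≡⟨ selfCount+nbrs≡classSize v (col v) ⟩
    classSize (col v)                    ∎
    where open ≤-Reasoning

  module _ (balanced : IsNBColouring m (K n) col) where

    classSize<own : ∀ v {c} → col v ≢ c → classSize c < classSize (col v)
    classSize<own v {c} col[v]≢c = begin-strict
      classSize c       ≡⟨ sym (nbrs≡classSize v col[v]≢c) ⟩
      nbrs v c          ≡⟨ balanced v c (col v) ⟩
      nbrs v (col v)    <⟨ nbrs-own<classSize v ⟩
      classSize (col v) ∎
      where open ≤-Reasoning

    balanced⇒monochromatic : ∀ u v → col u ≡ col v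
    balanced⇒monochromatic u v with col u ≟ col v
    ... | yes col[u]≡col[v] = col[u]≡col[v]
    ... | no col[u]≢col[v]  =
      ⊥-elim (<-asym (classSize<own u col[u]≢col[v]) (classSize<own v (col[u]≢col[v] ∘ sym)))

K-¬NBColouring : ∀ {n m} → 1 < m → (col : Fin (suc (suc n)) → Fin m) →
                 ¬ IsNBColouring m (K (suc (suc n))) col
K-¬NBColouring 1<m col balanced with ∃-≢ 1<m (col zero)
... | d , col[0]≢d = <⇒≢ (nbrs>0 zero (λ ()) (monochromatic (suc zero) zero)) (sym (begin
  nbrs zero (col zero) ≡⟨ balanced zero (col zero) d ⟩
  nbrs zero d          ≡⟨ nbrs≡classSize zero col[0]≢d ⟩
  classSize d          ≡⟨ classSize≡0 (λ v col[v]≡d → col[0]≢d (trans (monochromatic zero v) col[v]≡d)) ⟩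
  0                    ∎))
  where
  open CompleteGraph col
  open ≡-Reasoning
  monochromatic : ∀ u v → col u ≡ col v
  monochromatic = balanced⇒monochromatic balanced

K₁-admitsNBColouring : ∀ {m} → 0 < m → AdmitsNBColouring m (K 1)
K₁-admitsNBColouring (s≤s _) = (λ _ → zero) , λ { zero _ _ → refl }

theorem2p5 : (k n : ℕ) → k ≥ 1 → Prime (2 * k + 1) → n ≥ 1 →
    (AdmitsNBColouring (2 * k + 1) (K n) ⇔ n ≡ 1)
theorem2p5 k n _ prime[2k+1] n≥1 = mk⇔ (admits⇒n≡1 n≥1) λ { refl → K₁-admitsNBColouring (<⇒≤ 1<2k+1) }
  where
  1<2k+1 : 1 < 2 * k + 1
  1<2k+1 = nonTrivial⇒n>1 _ {{prime⇒nonTrivial prime[2k+1]}}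

  admits⇒n≡1 : ∀ {n} → n ≥ 1 → AdmitsNBColouring (2 * k + 1) (K n) → n ≡ 1
  admits⇒n≡1 {suc zero}    _ _                = refl
  admits⇒n≡1 {suc (suc _)} _ (col , balanced) = ⊥-elim (K-¬NBColouring 1<2k+1 col balanced)
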